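{- Let $N$ be a positive integer with two decompositions as sums of three positive integers, $N = a_1+a_2+a_3$ and $N = b_1+b_2+b_3$. Call a prime $p$ relevant if $p$ divides $N(N-1)(N-2)$ but neither of these two decompositions is $p$-acceptable. For $p$ relevant and $m \in \{N, N-1, N-2\}$, let $p^{v_p(m)}$ denote the exact power of $p$ dividing $m$; when $v_p(m)>0$ this is called a relevant prime power factor of $m$. Let $C$ be the product of all relevant prime power factors of $N-2$, the squares of all relevant prime power factors of $N-1$, and the cubes of all relevant prime power factors of $N$. Then $$C > 3^6\,(1 - 4N^{ -1}).$$ In particular, if $N\geq 12$ then $C > 486$, and if $N \geq 81$ then $C > 693$. If moreover $2$ is not a relevant prime, then $$C > 3^3\cdot 2^6\,(1-4N^{ -1}).$$
   Context: For a prime $p$, a decomposition $N = c_1 + \dots + c_k$ of a positive integer $N$ as a sum of positive integers is called $p$-acceptable if the multinomial coefficient $N!/(c_1!\cdots c_k!)$ is not divisible by $p$; equivalently, for each $t\ge 0$, the coefficient of $p^t$ in the base-$p$ expansion of $N$ equals the sum of the coefficients of $p^t$ in the base-$p$ expansions of $c_1,\dots,c_k$ (no carrying in base $p$). Note that if $2$ is relevant and $N$ is even, both the power of $2$ dividing $N-2$ and the cube of the power of $2$ dividing $N$ enter into $C$. -}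

module Defs where

open import Data.Nat using (ℕ; zero; suc; _+_; _*_; _∸_; _^_; _≤?_; _!; _/_)
open import Data.Nat.Properties using (m*n≢0; _!≢0; _!*_!≢0)
open import Data.Nat.Base using (>-nonZero; NonZero)
open import Data.Nat.Divisibility using (_∣_; _∣?_)
open import Data.Nat.Primality using (Prime; prime?)
open import Data.Product using (_×_; _,_)
open import Data.List using (List; upTo; map)
open import Data.Nat.ListAction using (product)
open import Data.Bool using (if_then_else_)
open import Relation.Nullary using (¬_; Dec; yes; no; ¬?; _×-dec_; does)

multinomial3 : ℕ → ℕ → ℕ → ℕ → ℕ
multinomial3 N a b c =
  (N ! / (a ! * b ! * c !)) {{m*n≢0 (a ! * b !) (c !) {{a !* b !≢0}} {{c !≢0}}}}

Acceptable : (p N c₁ c₂ c₃ : ℕ) → Set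
Acceptable p N c₁ c₂ c₃ = ¬ (p ∣ multinomial3 N c₁ c₂ c₃)

acceptable? : (p N c₁ c₂ c₃ : ℕ) → Dec (Acceptable p N c₁ c₂ c₃)
acceptable? p N c₁ c₂ c₃ = ¬? (p ∣? multinomial3 N c₁ c₂ c₃)

Relevant : (N a₁ a₂ a₃ b₁ b₂ b₃ p : ℕ) → Set
Relevant N a₁ a₂ a₃ b₁ b₂ b₃ p =
  Prime p × (p ∣ N * (N ∸ 1) * (N ∸ 2))
    × (¬ Acceptable p N a₁ a₂ a₃) × (¬ Acceptable p N b₁ b₂ b₃)

relevant? : (N a₁ a₂ a₃ b₁ b₂ b₃ p : ℕ) → Dec (Relevant N a₁ a₂ a₃ b₁ b₂ b₃ p)
relevant? N a₁ a₂ a₃ b₁ b₂ b₃ p =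
  prime? p ×-dec (p ∣? N * (N ∸ 1) * (N ∸ 2))
    ×-dec ¬? (acceptable? p N a₁ a₂ a₃) ×-dec ¬? (acceptable? p N b₁ b₂ b₃)

valFuel : ℕ → ℕ → ℕ → ℕ
valFuel zero p m = 0
valFuel (suc f) zero m = 0
valFuel (suc f) (suc zero) m = 0
valFuel (suc f) p@(suc (suc k)) m with p ∣? m
... | yes _ = suc (valFuel f p (m / p))
... | no _ = 0

-- v_p(m), the exponent of the exact power of p dividing m (fuel m suffices for m ≥ 1).
val : ℕ → ℕ → ℕ
val p m = valFuel m p m

contrib : (N a₁ a₂ a₃ b₁ b₂ b₃ p : ℕ) → ℕ
contrib N a₁ a₂ a₃ b₁ b₂ b₃ p =
  if does (relevant? N a₁ a₂ a₃ b₁ b₂ b₃ p)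
  then p ^ val p (N ∸ 2) * (p ^ val p (N ∸ 1)) ^ 2 * (p ^ val p N) ^ 3
  else 1

-- C : product over all p ≤ N (every relevant prime divides one of N, N-1, N-2 ≥ 1, hence is ≤ N).
C : (N a₁ a₂ a₃ b₁ b₂ b₃ : ℕ) → ℕ
C N a₁ a₂ a₃ b₁ b₂ b₃ = product (map (contrib N a₁ a₂ a₃ b₁ b₂ b₃) (upTo (suc N)))

-- Let W = (N-2)(N-1)²N³, A = a₁a₂a₃ and B = b₁b₂b₃.  The key claim is that W divides C·A·B,
-- checked one prime p at a time.  A relevant p contributes its whole p-part of W to C.  Otherwise
-- one decomposition, say a, is p-acceptable, i.e. by Kummer's theorem the aᵢ add up to N without
-- carries in base p.  If pᵏ exactly divides N - r with r ∈ {0, 1, 2}, the residues of the aᵢ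
-- modulo pᵏ then add up to r, so at least 3 - r of the aᵢ are divisible by pᵏ, and the p-part of
-- W divides A.  At p = 2 carry-freeness one binary digit higher yields an extra factor 2, so
-- 2W ∣ C·A·B when 2 is not relevant; moreover one of the aᵢ then holds the leading binary digit
-- of N and is at least the sum of the other two.  By AM-GM 27A ≤ N³, and 32A ≤ N³ when one part
-- dominates, so 729·W ≤ C·N⁶, resp. 1728·W ≤ C·N⁶; finally W > (N - 4)·N⁵ gives K·(N - 4) < C·N.

module Submission where

open import Defs
open import Data.Nat using (ℕ; _+_; _*_; _≤_; _<_; _>_)
open import Data.Integer using (ℤ; +_; _-_) renaming (_*_ to _*ℤ_; _<_ to _<ℤ_)
open import Data.Product using (_×_)
open import Relation.Binary.PropositionalEquality using (_≡_)
open import Relation.Nullary using (¬_)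

open import Data.Bool using (if_then_else_)
open import Data.Integer.Base as ℤ using () renaming (_≤_ to _≤ℤ_)
import Data.Integer.Properties as ℤ
open import Data.List using (_∷_; map; upTo)
open import Data.List.Membership.Propositional.Properties using (∈-map⁺; ∈-upTo⁺)
open import Data.List.Relation.Unary.All as All using (All; []; _∷_)
import Data.List.Relation.Unary.All.Properties as All
open import Data.Nat
open import Data.Nat.Combinatorics
  using (nCk≡n!/k![n-k]!; k![n∸k]!∣n!; nCk+nC[k+1]≡[n+1]C[k+1]; k>n⇒nCk≡0) renaming (_C_ to _choose_)
open import Data.Nat.Divisibility
open import Data.Nat.DivMod
open import Data.Nat.ListAction using (product)
open import Data.Nat.ListAction.Properties using (∈⇒∣product; product≢0)
open import Data.Nat.Primality
open import Data.Nat.Primality.Factorisation using (factorise; PrimeFactorisation)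
open import Data.Nat.Properties
open import Data.Nat.Solver using (module +-*-Solver)
open +-*-Solver using (solve; _:+_; _:*_; _:^_; _:=_; con)
open import Data.Nat.Tactic.RingSolver using (solve-∀)
open import Data.Product using (∃₂; ∃-syntax; _,_; proj₁; proj₂)
open import Data.Sum using (_⊎_; inj₁; inj₂; [_,_]′)
open import Function using (_∘_)
open import Relation.Binary.PropositionalEquality
open import Relation.Nullary using (yes; no; contradiction)
open import Relation.Nullary.Decidable using (dec-true; dec-false)

-- Residues and divisibility

module _ {q : ℕ} .{{_ : NonZero q}} where

  %-+-no-wrap : ∀ x y → x % q ≤ (x + y) % q → (x + y) % q ≡ x % q + y % q
  %-+-no-wrap x y x%≤ with x % q + y % q <? q
  ... | yes s<q = trans (%-distribˡ-+ x y q) (m<n⇒m%n≡m s<q)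
  ... | no s≮q = contradiction x%≤ (<⇒≱ wrapped<)
    where
    q≤s : q ≤ x % q + y % q
    q≤s = ≮⇒≥ s≮q
    wrapped< : (x + y) % q < x % q
    wrapped< = begin-strict
      (x + y) % q                ≡⟨ %-distribˡ-+ x y q ⟩
      (x % q + y % q) % q        ≡⟨ m≤n⇒[n∸m]%m≡n%m q≤s ⟨
      (x % q + y % q ∸ q) % q    ≤⟨ m%n≤m _ q ⟩
      x % q + y % q ∸ q          <⟨ ∸-monoˡ-< (+-monoʳ-< (x % q) (m%n<n y q)) q≤s ⟩
      x % q + q ∸ q              ≡⟨ m+n∸n≡m (x % q) q ⟩
      x % q                      ∎
      where open ≤-Reasoning

  suc-%-≤ : ∀ m → suc m % q ≤ suc (m % q)
  suc-%-≤ m = begin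
    (1 + m) % q            ≡⟨ %-distribˡ-+ 1 m q ⟩
    (1 % q + m % q) % q    ≤⟨ m%n≤m _ q ⟩
    1 % q + m % q          ≤⟨ +-monoˡ-≤ (m % q) (m%n≤m 1 q) ⟩
    suc (m % q)            ∎
    where open ≤-Reasoning

  suc-%-≡ : ∀ m → ¬ q ∣ suc m → suc m % q ≡ suc (m % q)
  suc-%-≡ m q∤1+m = trans reduce (m<n⇒m%n≡m no-wrap)
    where
    reduce : suc m % q ≡ suc (m % q) % q
    reduce = trans (cong (λ x → suc x % q) (m≡m%n+[m/n]*n m q)) ([m+kn]%n≡m%n (suc (m % q)) (m / q) q)
    no-wrap : suc (m % q) < q
    no-wrap with m≤n⇒m<n∨m≡n (m%n<n m q)
    ... | inj₁ 1+m%q<q = 1+m%q<q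
    ... | inj₂ 1+m%q≡q = contradiction (m%n≡0⇒n∣m _ q (trans reduce (trans (cong (_% q) 1+m%q≡q) (n%n≡0 q)))) q∤1+m

  %-offset : ∀ {r m} → q ∣ m → r < q → (r + m) % q ≡ r
  %-offset {r} q∣m r<q = trans (%-remove-+ʳ r q∣m) (m<n⇒m%n≡m r<q)

  ∣⇒≤% : ∀ {d x} → d ∣ x → d ∣ q → ¬ q ∣ x → d ≤ x % q
  ∣⇒≤% {d} {x} d∣x d∣q q∤x = ∣⇒≤ {{≢-nonZero (q∤x ∘ m%n≡0⇒n∣m x q)}} (%-presˡ-∣ d∣x d∣q)

∤⇒nonZero : ∀ {d n} → ¬ d ∣ n → NonZero n
∤⇒nonZero {d} d∤n = ≢-nonZero λ { refl → d∤n (d ∣0) }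

∣m+n∣n⇒∣m : ∀ {d m n} → d ∣ m + n → d ∣ n → d ∣ m
∣m+n∣n⇒∣m {d} {m} {n} d∣m+n d∣n = ∣m+n∣m⇒∣n (subst (d ∣_) (+-comm m n) d∣m+n) d∣n

2∣n⊎2∣1+n : ∀ n → 2 ∣ n ⊎ 2 ∣ suc n
2∣n⊎2∣1+n zero = inj₁ (2 ∣0)
2∣n⊎2∣1+n (suc n) with 2∣n⊎2∣1+n n
... | inj₁ (divides k n≡k*2) = inj₂ (divides (suc k) (cong (λ x → 2 + x) n≡k*2))
... | inj₂ 2∣1+n = inj₁ 2∣1+n

2∣m⇒4∣m⊎4∣2+m : ∀ {m} → 2 ∣ m → 4 ∣ m ⊎ 4 ∣ 2 + m
2∣m⇒4∣m⊎4∣2+m (divides k refl) with 2∣n⊎2∣1+n k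
... | inj₁ 2∣k = inj₁ (*-monoˡ-∣ 2 2∣k)
... | inj₂ 2∣1+k = inj₂ (*-monoˡ-∣ 2 2∣1+k)

4∤2 : ¬ 4 ∣ 2
4∤2 4∣2 with ∣⇒≤ 4∣2
... | s≤s (s≤s ())

prime∤1 : ∀ {p} → Prime p → ¬ p ∣ 1
prime∤1 p-prime = nonTrivial⇒≢1 {{prime⇒nonTrivial p-prime}} ∘ ∣1⇒≡1

odd-prime∤2 : ∀ {p} → Prime p → p ≢ 2 → ¬ p ∣ 2
odd-prime∤2 p-prime p≢2 p∣2 = p≢2 (≤-antisym (∣⇒≤ p∣2) (nonTrivial⇒n>1 _ {{prime⇒nonTrivial p-prime}}))

prime∤* : ∀ {p m n} → Prime p → ¬ p ∣ m → ¬ p ∣ n → ¬ p ∣ m * n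
prime∤* {m = m} {n} p-prime p∤m p∤n p∣m*n with euclidsLemma m n p-prime p∣m*n
... | inj₁ p∣m = p∤m p∣m
... | inj₂ p∣n = p∤n p∣n

prime∤^ : ∀ {p m} → Prime p → ¬ p ∣ m → ∀ n → ¬ p ∣ m ^ n
prime∤^ p-prime p∤m zero = prime∤1 p-prime
prime∤^ p-prime p∤m (suc n) = prime∤* p-prime p∤m (prime∤^ p-prime p∤m n)

prime∤prime : ∀ {p p′} → Prime p → Prime p′ → p′ ≢ p → ¬ p′ ∣ p
prime∤prime p-prime p′-prime p′≢p p′∣p with prime⇒irreducible p-prime p′∣p
... | inj₁ p′≡1 = nonTrivial⇒≢1 {{prime⇒nonTrivial p′-prime}} p′≡1
... | inj₂ p′≡p = p′≢p p′≡p

p^j∣m*n⇒p^j∣m : ∀ {p m n} → Prime p → ¬ p ∣ n → ∀ j → p ^ j ∣ m * n → p ^ j ∣ m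
p^j∣m*n⇒p^j∣m p-prime p∤n zero _ = 1∣ _
p^j∣m*n⇒p^j∣m {p} {m} {n} p-prime p∤n (suc j) p^[1+j]∣m*n
  with euclidsLemma m n p-prime (m*n∣⇒m∣ p (p ^ j) p^[1+j]∣m*n)
... | inj₂ p∣n = contradiction p∣n p∤n
... | inj₁ (divides k refl) =
  subst (p ^ suc j ∣_) (*-comm p k) (*-monoʳ-∣ p (p^j∣m*n⇒p^j∣m p-prime p∤n j p^j∣k*n))
  where
  instance
    p≢0 : NonZero p
    p≢0 = prime⇒nonZero p-prime
  p^j∣k*n : p ^ j ∣ k * n
  p^j∣k*n = *-cancelˡ-∣ p (subst (p ^ suc j ∣_) (trans (cong (_* n) (*-comm k p)) (*-assoc p k n)) p^[1+j]∣m*n)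

product∣-byPrimePowers : ∀ {ps n} → All Prime ps →
  (∀ {p} j → Prime p → p ^ j ∣ product ps → p ^ j ∣ n) → product ps ∣ n
product∣-byPrimePowers [] _ = 1∣ _
product∣-byPrimePowers {p ∷ ps} {n} (p-prime ∷ ps-prime) local =
  subst (p * product ps ∣_) (sym n≡p*k) (*-monoʳ-∣ p (product∣-byPrimePowers ps-prime local-k))
  where
  instance
    p≢0 : NonZero p
    p≢0 = prime⇒nonZero p-prime
  p∣n : p ∣ n
  p∣n = subst (_∣ n) (*-identityʳ p) (local 1 p-prime (*-monoʳ-∣ p (1∣ product ps)))
  k : ℕ
  k = quotient p∣n
  n≡p*k : n ≡ p * k
  n≡p*k = m∣n⇒n≡m*quotient p∣n
  local-k : ∀ {p′} j → Prime p′ → p′ ^ j ∣ product ps → p′ ^ j ∣ k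
  local-k {p′} j p′-prime p′^j∣ps with p′ ≟ p
  ... | yes refl = *-cancelˡ-∣ p (subst (p ^ suc j ∣_) n≡p*k (local (suc j) p-prime (*-monoʳ-∣ p p′^j∣ps)))
  ... | no p′≢p = p^j∣m*n⇒p^j∣m p′-prime (prime∤prime p-prime p′-prime p′≢p) j
        (subst (p′ ^ j ∣_) (trans n≡p*k (*-comm p k)) (local j p′-prime (∣-trans p′^j∣ps (n∣m*n p))))

∣-byPrimePowers : ∀ m {n} .{{_ : NonZero m}} → (∀ {p} j → Prime p → p ^ j ∣ m → p ^ j ∣ n) → m ∣ n
∣-byPrimePowers m {n} local = subst (_∣ n) (sym isFactorisation)
  (product∣-byPrimePowers factorsPrime λ j p-prime → local j p-prime ∘ subst (_ ∣_) (sym isFactorisation))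
  where open PrimeFactorisation (factorise m)

∣-byPrimeParts : ∀ m {n} .{{_ : NonZero m}} →
  (∀ {p} → Prime p → ∃₂ λ d u → m ≡ d * u × ¬ p ∣ u × d ∣ n) → m ∣ n
∣-byPrimeParts m {n} parts = ∣-byPrimePowers m p^j∣n
  where
  p^j∣n : ∀ {p} j → Prime p → p ^ j ∣ m → p ^ j ∣ n
  p^j∣n {p} j p-prime p^j∣m with parts p-prime
  ... | d , u , m≡d*u , p∤u , d∣n = ∣-trans (p^j∣m*n⇒p^j∣m p-prime p∤u j (subst (p ^ j ∣_) m≡d*u p^j∣m)) d∣n

-- p-adic valuations

-- The clauses of valFuel only unfold for a divisor written as 2 + k.
valFuel-factor : ∀ k f m .{{_ : NonZero m}} → m ≤ f →
  ∃[ u ] m ≡ (2 + k) ^ valFuel f (2 + k) m * u × ¬ 2 + k ∣ u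
valFuel-factor k zero m m≤0 = contradiction m≤0 (<⇒≱ (>-nonZero⁻¹ m))
valFuel-factor k (suc f) m m≤1+f with 2 + k ∣? m
... | no p∤m = m , sym (*-identityˡ m) , p∤m
... | yes p∣m with valFuel-factor k f (m / p) {{>-nonZero m/p>0}} m/p≤f
  where
  p : ℕ
  p = 2 + k
  m/p>0 : m / p > 0
  m/p>0 = m≥n⇒m/n>0 (∣⇒≤ p∣m)
  m/p≤f : m / p ≤ f
  m/p≤f = <⇒≤pred (≤-trans (m/n<m m p (s≤s (s≤s z≤n))) m≤1+f)
...   | u , m/p≡ , p∤u = u , m≡ , p∤u
  where
  p v : ℕ
  p = 2 + k
  v = valFuel f p (m / p)
  m≡ : m ≡ p * p ^ v * u
  m≡ = begin
    m                ≡⟨ m*[n/m]≡n p∣m ⟨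
    p * (m / p)      ≡⟨ cong (p *_) m/p≡ ⟩
    p * (p ^ v * u)  ≡⟨ *-assoc p (p ^ v) u ⟨
    p * p ^ v * u    ∎
    where open ≡-Reasoning

module _ {p : ℕ} (p-prime : Prime p) where
  private instance
    p≢0 : NonZero p
    p≢0 = prime⇒nonZero p-prime

  val-factor : ∀ m .{{_ : NonZero m}} → ∃[ u ] m ≡ p ^ val p m * u × ¬ p ∣ u
  val-factor m with nonTrivial⇒n>1 p {{prime⇒nonTrivial p-prime}}
  ... | s≤s (s≤s {n = k} z≤n) = valFuel-factor k m m ≤-refl

  p^val∣ : ∀ m .{{_ : NonZero m}} → p ^ val p m ∣ m
  p^val∣ m with val-factor m
  ... | u , m≡ , _ = divides u (trans m≡ (*-comm _ u))

  ∣p^val : ∀ {j} m .{{_ : NonZero m}} → p ^ j ∣ m → p ^ j ∣ p ^ val p m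
  ∣p^val {j} m p^j∣m with val-factor m
  ... | u , m≡ , p∤u = p^j∣m*n⇒p^j∣m p-prime p∤u j (subst (p ^ j ∣_) m≡ p^j∣m)

  p≤p^val : ∀ {m} .{{_ : NonZero m}} → p ∣ m → p ≤ p ^ val p m
  p≤p^val {m} p∣m = subst (_≤ p ^ val p m) (*-identityʳ p)
    (∣⇒≤ {{m^n≢0 p (val p m)}} (∣p^val {j = 1} m (subst (_∣ m) (sym (*-identityʳ p)) p∣m)))

  p-adic-unique : ∀ {u u′} k v → p ^ k * u ≡ p ^ v * u′ → ¬ p ∣ u → ¬ p ∣ u′ → k ≡ v
  p-adic-unique zero zero _ _ _ = refl
  p-adic-unique {u} {u′} (suc k) zero eq _ p∤u′ = contradiction
    (divides (p ^ k * u) (trans (sym (trans eq (*-identityˡ u′))) (trans (*-assoc p _ u) (*-comm p _)))) p∤u′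
  p-adic-unique {u} {u′} zero (suc v) eq p∤u _ = contradiction
    (divides (p ^ v * u′) (trans (trans (sym (*-identityˡ u)) eq) (trans (*-assoc p _ u′) (*-comm p _)))) p∤u
  p-adic-unique {u} {u′} (suc k) (suc v) eq p∤u p∤u′ =
    cong suc (p-adic-unique k v (*-cancelˡ-≡ (p ^ k * u) (p ^ v * u′) p
      (trans (sym (*-assoc p _ u)) (trans eq (*-assoc p _ u′)))) p∤u p∤u′)

  val-unique : ∀ {m u} k → m ≡ p ^ k * u → ¬ p ∣ u → val p m ≡ k
  val-unique {m} {u} k m≡ p∤u with val-factor m {{m≢0}}
    where
    m≢0 : NonZero m
    m≢0 = subst NonZero (sym m≡) (m*n≢0 (p ^ k) u {{m^n≢0 p k}} {{∤⇒nonZero p∤u}})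
  ... | u′ , m≡′ , p∤u′ = sym (p-adic-unique k (val p m) (trans (sym m≡) m≡′) p∤u p∤u′)

  val≡0 : ∀ {m} → ¬ p ∣ m → val p m ≡ 0
  val≡0 {m} p∤m = val-unique 0 (sym (*-identityˡ m)) p∤m

  val≡1 : ∀ {m} → p ∣ m → ¬ p * p ∣ m → val p m ≡ 1
  val≡1 {m} p∣m p²∤m = val-unique 1 m≡p¹*k p∤k
    where
    k : ℕ
    k = quotient p∣m
    m≡p¹*k : m ≡ p ^ 1 * k
    m≡p¹*k = trans (m∣n⇒n≡m*quotient p∣m) (cong (_* k) (sym (*-identityʳ p)))
    p∤k : ¬ p ∣ k
    p∤k p∣k = p²∤m (subst (p * p ∣_) (sym (m∣n⇒n≡m*quotient p∣m)) (*-monoʳ-∣ p p∣k))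

-- Kummer's theorem for trinomial coefficients

n!≡nCk*[k!*[n∸k]!] : ∀ {n k} → k ≤ n → n ! ≡ (n choose k) * (k ! * (n ∸ k) !)
n!≡nCk*[k!*[n∸k]!] {n} {k} k≤n = begin
  n !                                                  ≡⟨ m/n*n≡m {{k !* (n ∸ k) !≢0}} (k![n∸k]!∣n! k≤n) ⟨
  (n ! / (k ! * (n ∸ k) !)) {{k !* (n ∸ k) !≢0}} * _  ≡⟨ cong (_* (k ! * (n ∸ k) !)) (nCk≡n!/k![n-k]! k≤n) ⟨
  (n choose k) * (k ! * (n ∸ k) !)                     ∎
  where open ≡-Reasoning

[1+k]*[1+n]C[1+k]≡[1+n]*nCk : ∀ {n k} → k ≤ n → suc k * (suc n choose suc k) ≡ suc n * (n choose k)
[1+k]*[1+n]C[1+k]≡[1+n]*nCk {n} {k} k≤n = *-cancelʳ-≡ _ _ (k ! * (n ∸ k) !) {{k !* (n ∸ k) !≢0}} (begin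
  suc k * (suc n choose suc k) * (k ! * (n ∸ k) !)   ≡⟨ regroup (suc k) (suc n choose suc k) (k !) ((n ∸ k) !) ⟩
  (suc n choose suc k) * (suc k ! * (n ∸ k) !)       ≡⟨ n!≡nCk*[k!*[n∸k]!] (s≤s k≤n) ⟨
  suc n * n !                                         ≡⟨ cong (suc n *_) (n!≡nCk*[k!*[n∸k]!] k≤n) ⟩
  suc n * ((n choose k) * (k ! * (n ∸ k) !))          ≡⟨ *-assoc (suc n) (n choose k) _ ⟨
  suc n * (n choose k) * (k ! * (n ∸ k) !)            ∎)
  where
  open ≡-Reasoning
  regroup : ∀ a b c d → a * b * (c * d) ≡ b * (a * c * d)
  regroup = solve-∀

multinomial3≡binomials : ∀ a b c → multinomial3 (a + b + c) a b c ≡ ((a + b + c) choose a) * ((b + c) choose b)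
multinomial3≡binomials a b c = begin
  multinomial3 n a b c   ≡⟨ /-congˡ {{d≢0}} n!≡x*d ⟩
  (x * d / d) {{d≢0}}    ≡⟨ m*n/n≡m x d {{d≢0}} ⟩
  x                      ∎
  where
  open ≡-Reasoning
  n d x : ℕ
  n = a + b + c
  d = a ! * b ! * c !
  x = (n choose a) * ((b + c) choose b)
  d≢0 : NonZero d
  d≢0 = m*n≢0 (a ! * b !) (c !) {{a !* b !≢0}} {{c !≢0}}
  n∸a≡b+c : n ∸ a ≡ b + c
  n∸a≡b+c = trans (cong (_∸ a) (+-assoc a b c)) (m+n∸m≡n a (b + c))
  [b+c]!≡ : (b + c) ! ≡ ((b + c) choose b) * (b ! * c !)
  [b+c]!≡ = trans (n!≡nCk*[k!*[n∸k]!] (m≤m+n b c)) (cong (λ y → ((b + c) choose b) * (b ! * y !)) (m+n∸m≡n b c))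
  regroup : ∀ x y z u v → x * (y * (z * (u * v))) ≡ x * z * (y * u * v)
  regroup = solve-∀
  n!≡x*d : n ! ≡ x * d
  n!≡x*d = begin
    n !                                                        ≡⟨ n!≡nCk*[k!*[n∸k]!] (≤-trans (m≤m+n a b) (m≤m+n (a + b) c)) ⟩
    (n choose a) * (a ! * (n ∸ a) !)                           ≡⟨ cong (λ y → (n choose a) * (a ! * y !)) n∸a≡b+c ⟩
    (n choose a) * (a ! * (b + c) !)                           ≡⟨ cong (λ y → (n choose a) * (a ! * y)) [b+c]!≡ ⟩
    (n choose a) * (a ! * (((b + c) choose b) * (b ! * c !)))  ≡⟨ regroup (n choose a) (a !) _ (b !) (c !) ⟩
    x * d                                                      ∎

record CarryFreeMod (q n a b c : ℕ) .{{_ : NonZero q}} : Set where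
  constructor carry-free
  field residues : a % q + b % q + c % q ≡ n % q

-- Carry-free addition in base p, stated through the residues modulo every power of p.
CarryFree : (p n a b c : ℕ) .{{_ : NonZero p}} → Set
CarryFree p n a b c = ∀ j → CarryFreeMod (p ^ j) n a b c {{m^n≢0 p j}}

module _ {p : ℕ} (p-prime : Prime p) (j : ℕ) where
  private instance
    p≢0 : NonZero p
    p≢0 = prime⇒nonZero p-prime
    p^j≢0 : NonZero (p ^ j)
    p^j≢0 = m^n≢0 p j

  binomial-no-borrow : ∀ n k → ¬ p ∣ n choose k → k ≤ n → k % p ^ j ≤ n % p ^ j
  binomial-no-borrow zero .zero _ z≤n = ≤-refl
  binomial-no-borrow (suc n) zero _ _ = ≤-trans (m%n≤m 0 (p ^ j)) z≤n
  binomial-no-borrow (suc n) (suc k) p∤C (s≤s k≤n) with p ^ j ∣? suc n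
  ... | yes p^j∣1+n = subst (_≤ suc n % p ^ j) (sym (n∣m⇒m%n≡0 (suc k) (p ^ j) p^j∣1+k)) z≤n
    where
    p^j∣1+k : p ^ j ∣ suc k
    p^j∣1+k = p^j∣m*n⇒p^j∣m p-prime p∤C j
      (subst (p ^ j ∣_) (sym ([1+k]*[1+n]C[1+k]≡[1+n]*nCk k≤n)) (∣m⇒∣m*n _ p^j∣1+n))
  ... | no p^j∤1+n with p ∣? n choose k
  ...   | no p∤C′ = begin
    suc k % p ^ j      ≤⟨ suc-%-≤ k ⟩
    suc (k % p ^ j)    ≤⟨ s≤s (binomial-no-borrow n k p∤C′ k≤n) ⟩
    suc (n % p ^ j)    ≡⟨ suc-%-≡ n p^j∤1+n ⟨
    suc n % p ^ j      ∎
    where open ≤-Reasoning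
  ...   | yes p∣C′ = begin
    suc k % p ^ j      ≤⟨ binomial-no-borrow n (suc k) p∤C″ 1+k≤n ⟩
    n % p ^ j          ≤⟨ n≤1+n _ ⟩
    suc (n % p ^ j)    ≡⟨ suc-%-≡ n p^j∤1+n ⟨
    suc n % p ^ j      ∎
    where
    open ≤-Reasoning
    p∤C″ : ¬ p ∣ n choose suc k
    p∤C″ p∣C″ = p∤C (subst (p ∣_) (nCk+nC[k+1]≡[n+1]C[k+1] n k) (∣m∣n⇒∣m+n p∣C′ p∣C″))
    1+k≤n : suc k ≤ n
    1+k≤n with suc k ≤? n
    ... | yes 1+k≤n = 1+k≤n
    ... | no 1+k≰n = contradiction (subst (p ∣_) (sym (k>n⇒nCk≡0 (≰⇒> 1+k≰n))) (p ∣0)) p∤C″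

  binomial-carry-free : ∀ m n → ¬ p ∣ (m + n) choose m → m % p ^ j + n % p ^ j ≡ (m + n) % p ^ j
  binomial-carry-free m n p∤C = sym (%-+-no-wrap m n (binomial-no-borrow (m + n) m p∤C (m≤m+n m n)))

  multinomial-carry-free : ∀ a b c → ¬ p ∣ multinomial3 (a + b + c) a b c →
    CarryFreeMod (p ^ j) (a + b + c) a b c
  multinomial-carry-free a b c p∤M = carry-free (begin
    a % p ^ j + b % p ^ j + c % p ^ j      ≡⟨ +-assoc (a % p ^ j) _ _ ⟩
    a % p ^ j + (b % p ^ j + c % p ^ j)    ≡⟨ cong (λ x → a % p ^ j + x) (binomial-carry-free b c p∤C₂) ⟩
    a % p ^ j + (b + c) % p ^ j            ≡⟨ binomial-carry-free a (b + c) p∤C₁ ⟩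
    (a + (b + c)) % p ^ j                  ≡⟨ cong (_% p ^ j) (+-assoc a b c) ⟨
    (a + b + c) % p ^ j                    ∎)
    where
    open ≡-Reasoning
    p∤C₁ : ¬ p ∣ (a + (b + c)) choose a
    p∤C₁ = p∤M ∘ subst (p ∣_) (sym (multinomial3≡binomials a b c)) ∘ ∣m⇒∣m*n _
             ∘ subst (λ n → p ∣ n choose a) (sym (+-assoc a b c))
    p∤C₂ : ¬ p ∣ (b + c) choose b
    p∤C₂ = p∤M ∘ subst (p ∣_) (sym (multinomial3≡binomials a b c)) ∘ ∣n⇒∣m*n ((a + b + c) choose a)

acceptable⇒carryFree : ∀ {p n a b c} (p-prime : Prime p) → n ≡ a + b + c → Acceptable p n a b c →
  CarryFree p n a b c {{prime⇒nonZero p-prime}}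
acceptable⇒carryFree {a = a} {b} {c} p-prime refl acc j = multinomial-carry-free p-prime j a b c acc

-- Carry-free triples

-- R holds for one of the pairs {u, v} of {a, b, c}, w being the remaining part.
data Arranged (R : ℕ → ℕ → ℕ → Set) (a b c : ℕ) : Set where
  pair-ab : R a b c → Arranged R a b c
  pair-ac : R a c b → Arranged R a b c
  pair-bc : R b c a → Arranged R a b c

arranged-map : ∀ {R S : ℕ → ℕ → ℕ → Set} {a b c} →
  (∀ {u v w} → R u v w → S u v w) → Arranged R a b c → Arranged S a b c
arranged-map f (pair-ab r) = pair-ab (f r)
arranged-map f (pair-ac r) = pair-ac (f r)
arranged-map f (pair-bc r) = pair-bc (f r)

arranged-∘ : ∀ {R : ℕ → ℕ → ℕ → Set} (f : ℕ → ℕ) {a b c} →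
  Arranged R (f a) (f b) (f c) → Arranged (λ u v w → R (f u) (f v) (f w)) a b c
arranged-∘ f (pair-ab r) = pair-ab r
arranged-∘ f (pair-ac r) = pair-ac r
arranged-∘ f (pair-bc r) = pair-bc r

arranged-with : ∀ {R : ℕ → ℕ → ℕ → Set} {P : ℕ → Set} {a b c} →
  P a × P b × P c → Arranged R a b c → Arranged (λ u v w → R u v w × P w) a b c
arranged-with (_ , _ , Pc) (pair-ab r) = pair-ab (r , Pc)
arranged-with (_ , Pb , _) (pair-ac r) = pair-ac (r , Pb)
arranged-with (Pa , _ , _) (pair-bc r) = pair-bc (r , Pa)

arranged-∣ : ∀ {d a b c} → Arranged (λ u v w → d ∣ u * v * w) a b c → d ∣ a * b * c
arranged-∣ (pair-ab d∣abc) = d∣abc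
arranged-∣ {d} {a} {b} {c} (pair-ac d∣acb) = subst (d ∣_) (acb≡abc a b c) d∣acb
  where
  acb≡abc : ∀ a b c → a * c * b ≡ a * b * c
  acb≡abc = solve-∀
arranged-∣ {d} {a} {b} {c} (pair-bc d∣bca) = subst (d ∣_) (bca≡abc a b c) d∣bca
  where
  bca≡abc : ∀ a b c → b * c * a ≡ a * b * c
  bca≡abc = solve-∀

sum≡0 : ∀ {x y z} → x + y + z ≡ 0 → x ≡ 0 × y ≡ 0 × z ≡ 0
sum≡0 {zero} {zero} {zero} _ = refl , refl , refl

sum≡1 : ∀ {x y z} → x + y + z ≡ 1 → Arranged (λ u v _ → u ≡ 0 × v ≡ 0) x y z
sum≡1 {zero} {zero} _ = pair-ab (refl , refl)
sum≡1 {zero} {suc zero} {zero} _ = pair-ac (refl , refl)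
sum≡1 {suc zero} {zero} {zero} _ = pair-bc (refl , refl)

sum≡2 : ∀ {x y z} → x + y + z ≡ 2 → Arranged (λ _ _ w → w ≡ 0) x y z
sum≡2 {zero} _ = pair-bc refl
sum≡2 {suc x} {zero} _ = pair-ac refl
sum≡2 {suc x} {suc y} {zero} _ = pair-ab refl
sum≡2 {suc zero} {suc zero} {suc z} ()
sum≡2 {suc zero} {suc (suc y)} {suc z} ()
sum≡2 {suc (suc x)} {suc y} {suc z} eq =
  contradiction (m+n≡0⇒n≡0 (x + suc y) (suc-injective (suc-injective eq))) λ ()

sum≡2-without-1 : ∀ {x y z} → x + y + z ≡ 2 → x ≢ 1 → y ≢ 1 → z ≢ 1 →
  Arranged (λ u v _ → u ≡ 0 × v ≡ 0) x y z
sum≡2-without-1 {zero} {zero} _ _ _ _ = pair-ab (refl , refl)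
sum≡2-without-1 {zero} {suc zero} _ _ y≢1 _ = contradiction refl y≢1
sum≡2-without-1 {zero} {suc (suc zero)} {zero} _ _ _ _ = pair-ac (refl , refl)
sum≡2-without-1 {suc zero} _ x≢1 _ _ = contradiction refl x≢1
sum≡2-without-1 {suc (suc zero)} {zero} {zero} _ _ _ _ = pair-bc (refl , refl)

module _ {q n a b c : ℕ} .{{_ : NonZero q}} (cf : CarryFreeMod q n a b c) where
  open CarryFreeMod cf

  private
    zero-residues : ∀ {a b c} → Arranged (λ u v _ → u ≡ 0 × v ≡ 0) (a % q) (b % q) (c % q) →
      Arranged (λ u v _ → q ∣ u × q ∣ v) a b c
    zero-residues = arranged-map (λ (u%q≡0 , v%q≡0) → m%n≡0⇒n∣m _ q u%q≡0 , m%n≡0⇒n∣m _ q v%q≡0)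
                  ∘ arranged-∘ (_% q)

  all-divisible : q ∣ n → q ∣ a × q ∣ b × q ∣ c
  all-divisible q∣n with sum≡0 (trans residues (n∣m⇒m%n≡0 n q q∣n))
  ... | a%q≡0 , b%q≡0 , c%q≡0 = m%n≡0⇒n∣m a q a%q≡0 , m%n≡0⇒n∣m b q b%q≡0 , m%n≡0⇒n∣m c q c%q≡0

  pair-divisible : n % q ≡ 1 → Arranged (λ u v _ → q ∣ u × q ∣ v) a b c
  pair-divisible n%q≡1 = zero-residues (sum≡1 (trans residues n%q≡1))

  one-divisible : n % q ≡ 2 → Arranged (λ _ _ w → q ∣ w) a b c
  one-divisible n%q≡2 = arranged-map (λ {_} {_} {w} → m%n≡0⇒n∣m w q) (arranged-∘ (_% q) (sum≡2 (trans residues n%q≡2)))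

  pair-divisible-even : n % q ≡ 2 → 2 ∣ q → 2 ∣ a × 2 ∣ b × 2 ∣ c → Arranged (λ u v _ → q ∣ u × q ∣ v) a b c
  pair-divisible-even n%q≡2 2∣q (2∣a , 2∣b , 2∣c) =
    zero-residues (sum≡2-without-1 (trans residues n%q≡2) (odd-residue 2∣a) (odd-residue 2∣b) (odd-residue 2∣c))
    where
    odd-residue : ∀ {x} → 2 ∣ x → x % q ≢ 1
    odd-residue 2∣x x%q≡1 = prime∤1 prime[2] (subst (2 ∣_) x%q≡1 (%-presˡ-∣ 2∣x 2∣q))

  pair-bounds : (a % q + b % q < q) × (a % q + c % q < q) × (b % q + c % q < q)
  pair-bounds = below (m≤m+n (a % q + b % q) (c % q))
              , below (+-monoˡ-≤ (c % q) (m≤m+n (a % q) (b % q)))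
              , below (+-monoˡ-≤ (c % q) (m≤n+m (b % q) (a % q)))
    where
    below : ∀ {x} → x ≤ a % q + b % q + c % q → x < q
    below x≤ = ≤-<-trans (≤-trans x≤ (≤-reflexive residues)) (m%n<n n q)

  arranged-bounded : ∀ {R : ℕ → ℕ → ℕ → Set} → Arranged R a b c →
    Arranged (λ u v w → R u v w × u % q + v % q < q) a b c
  arranged-bounded (pair-ab r) = pair-ab (r , proj₁ pair-bounds)
  arranged-bounded (pair-ac r) = pair-ac (r , proj₁ (proj₂ pair-bounds))
  arranged-bounded (pair-bc r) = pair-bc (r , proj₂ (proj₂ pair-bounds))

module _ {d : ℕ} .{{_ : NonZero (2 * d)}} where

  -- Two parts that are both exactly divisible by d would carry into the digit of 2d.
  exact-pair : ∀ {u v} → d ∣ u → d ∣ v → u % (2 * d) + v % (2 * d) < 2 * d → 2 * d ∣ u ⊎ 2 * d ∣ v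
  exact-pair {u} {v} d∣u d∣v bound with 2 * d ∣? u | 2 * d ∣? v
  ... | yes 2d∣u | _ = inj₁ 2d∣u
  ... | no _ | yes 2d∣v = inj₂ 2d∣v
  ... | no 2d∤u | no 2d∤v = contradiction bound (≤⇒≯ (begin
    2 * d                          ≡⟨ cong (λ x → d + x) (+-identityʳ d) ⟩
    d + d                          ≤⟨ +-mono-≤ (∣⇒≤% d∣u (n∣m*n 2) 2d∤u) (∣⇒≤% d∣v (n∣m*n 2) 2d∤v) ⟩
    u % (2 * d) + v % (2 * d)      ∎))
    where open ≤-Reasoning

  two-of-three : ∀ {n a b c} → CarryFreeMod (2 * d) n a b c → d ∣ a × d ∣ b × d ∣ c →
    Arranged (λ u v _ → 2 * d ∣ u × 2 * d ∣ v) a b c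
  two-of-three cf (d∣a , d∣b , d∣c) with pair-bounds cf
  ... | ab< , ac< , bc< with exact-pair d∣a d∣b ab<
  ...   | inj₁ 2d∣a with exact-pair d∣b d∣c bc<
  ...     | inj₁ 2d∣b = pair-ab (2d∣a , 2d∣b)
  ...     | inj₂ 2d∣c = pair-ac (2d∣a , 2d∣c)
  two-of-three cf (d∣a , d∣b , d∣c) | ab< , ac< , bc< | inj₂ 2d∣b with exact-pair d∣a d∣c ac<
  ...     | inj₁ 2d∣a = pair-ab (2d∣a , 2d∣b)
  ...     | inj₂ 2d∣c = pair-bc (2d∣b , 2d∣c)

∣-pair : ∀ {d u v} → d ∣ u → d ∣ v → 2 * d ∣ u ⊎ 2 * d ∣ v → d * (2 * d) ∣ u * v
∣-pair {d} {u} {v} d∣u d∣v (inj₁ 2d∣u) = subst (d * (2 * d) ∣_) (*-comm v u) (*-pres-∣ d∣v 2d∣u)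
∣-pair d∣u d∣v (inj₂ 2d∣v) = *-pres-∣ d∣u 2d∣v

weight : ℕ → ℕ
weight N = (N ∸ 2) * (N ∸ 1) ^ 2 * N ^ 3

-- The p-part of weight N; for a relevant prime p it is the factor contributed by p to C.
weightPart : ℕ → ℕ → ℕ
weightPart p N = p ^ val p (N ∸ 2) * (p ^ val p (N ∸ 1)) ^ 2 * (p ^ val p N) ^ 3

weightPart-vals : ∀ {p N v₂ v₁ v₀} → val p (N ∸ 2) ≡ v₂ → val p (N ∸ 1) ≡ v₁ → val p N ≡ v₀ →
  weightPart p N ≡ p ^ v₂ * (p ^ v₁) ^ 2 * (p ^ v₀) ^ 3
weightPart-vals refl refl refl = refl

weight>0 : ∀ {N} → 3 ≤ N → weight N > 0
weight>0 {suc (suc (suc n))} (s≤s (s≤s (s≤s z≤n))) =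
  *-mono-≤ (*-mono-≤ (s≤s (z≤n {n})) (m^n>0 (2 + n) 2)) (m^n>0 (3 + n) 3)

module _ {p : ℕ} (p-prime : Prime p) where
  private instance
    p≢0 : NonZero p
    p≢0 = prime⇒nonZero p-prime

  weightPart>0 : ∀ N → weightPart p N > 0
  weightPart>0 N = *-mono-≤ (*-mono-≤ (p^v>0 (val p (N ∸ 2))) (m^n>0 _ {{>-nonZero (p^v>0 (val p (N ∸ 1)))}} 2))
                            (m^n>0 _ {{>-nonZero (p^v>0 (val p N))}} 3)
    where
    p^v>0 : ∀ v → p ^ v > 0
    p^v>0 = m^n>0 p

  weightPart≡1 : ∀ {N} → ¬ p ∣ N → ¬ p ∣ N ∸ 1 → ¬ p ∣ N ∸ 2 → weightPart p N ≡ 1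
  weightPart≡1 {N} p∤N p∤N-1 p∤N-2 = weightPart-vals {p} {N} (val≡0 p-prime p∤N-2) (val≡0 p-prime p∤N-1) (val≡0 p-prime p∤N)

  weight-split : ∀ {N} → 3 ≤ N → ∃[ u ] weight N ≡ weightPart p N * u × ¬ p ∣ u
  weight-split {N@(suc (suc (suc n)))} (s≤s (s≤s (s≤s z≤n)))
    with val-factor p-prime (N ∸ 2) | val-factor p-prime (N ∸ 1) | val-factor p-prime N
  ... | u₂ , N-2≡ , p∤u₂ | u₁ , N-1≡ , p∤u₁ | u₀ , N≡ , p∤u₀ =
    u₂ * u₁ ^ 2 * u₀ ^ 3 ,
    trans (cong₂ _*_ (cong₂ (λ x y → x * y ^ 2) N-2≡ N-1≡) (cong (_^ 3) N≡))
          (regroup (p ^ val p (N ∸ 2)) u₂ (p ^ val p (N ∸ 1)) u₁ (p ^ val p N) u₀) ,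
    prime∤* p-prime (prime∤* p-prime p∤u₂ (prime∤^ p-prime p∤u₁ 2)) (prime∤^ p-prime p∤u₀ 3)
    where
    regroup : ∀ x₂ y₂ x₁ y₁ x₀ y₀ →
      x₂ * y₂ * (x₁ * y₁) ^ 2 * (x₀ * y₀) ^ 3 ≡ x₂ * x₁ ^ 2 * x₀ ^ 3 * (y₂ * y₁ ^ 2 * y₀ ^ 3)
    regroup = solve 6 (λ x₂ y₂ x₁ y₁ x₀ y₀ →
      x₂ :* y₂ :* (x₁ :* y₁) :^ 2 :* (x₀ :* y₀) :^ 3 := x₂ :* x₁ :^ 2 :* x₀ :^ 3 :* (y₂ :* y₁ :^ 2 :* y₀ :^ 3)) refl

module _ {p n a b c : ℕ} (p-prime : Prime p) (cf : CarryFree p (3 + n) a b c {{prime⇒nonZero p-prime}}) where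
  private instance
    p≢0 : NonZero p
    p≢0 = prime⇒nonZero p-prime

  private
    p≥2 : 2 ≤ p
    p≥2 = nonTrivial⇒n>1 p {{prime⇒nonTrivial p-prime}}

  weightPart∣product-p∣N : p ≢ 2 → p ∣ 3 + n → weightPart p (3 + n) ∣ a * b * c
  weightPart∣product-p∣N p≢2 p∣N = subst (_∣ a * b * c) (sym T≡q³) (cube-∣ (all-divisible (cf k) (p^val∣ p-prime (3 + n))))
    where
    k q : ℕ
    k = val p (3 + n)
    q = p ^ k
    instance
      q≢0 : NonZero q
      q≢0 = m^n≢0 p k
    cube-∣ : q ∣ a × q ∣ b × q ∣ c → q * q * q ∣ a * b * c
    cube-∣ (q∣a , q∣b , q∣c) = *-pres-∣ (*-pres-∣ q∣a q∣b) q∣c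
    T≡q³ : weightPart p (3 + n) ≡ q * q * q
    T≡q³ = trans (weightPart-vals {p} {3 + n} (val≡0 p-prime (odd-prime∤2 p-prime p≢2 ∘ ∣m+n∣n⇒∣m p∣N))
                   (val≡0 p-prime (prime∤1 p-prime ∘ ∣m+n∣n⇒∣m p∣N)) refl) (shape q)
      where
      shape : ∀ x → 1 * 1 ^ 2 * x ^ 3 ≡ x * x * x
      shape = solve 1 (λ x → con 1 :* con 1 :^ 2 :* x :^ 3 := x :* x :* x) refl

  weightPart∣product-p∣N∸1 : p ∣ 2 + n → weightPart p (3 + n) ∣ a * b * c
  weightPart∣product-p∣N∸1 p∣N-1 = subst (_∣ a * b * c) (sym T≡q²)
    (arranged-∣ (arranged-map (λ {u} {v} {w} (q∣u , q∣v) → ∣m⇒∣m*n w (*-pres-∣ q∣u q∣v)) (pair-divisible (cf k) N%q≡1)))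
    where
    k q : ℕ
    k = val p (2 + n)
    q = p ^ k
    instance
      q≢0 : NonZero q
      q≢0 = m^n≢0 p k
    T≡q² : weightPart p (3 + n) ≡ q * q
    T≡q² = trans (weightPart-vals {p} {3 + n} (val≡0 p-prime (prime∤1 p-prime ∘ ∣m+n∣n⇒∣m p∣N-1)) refl
                   (val≡0 p-prime (prime∤1 p-prime ∘ λ p∣N → ∣m+n∣n⇒∣m {m = 1} p∣N p∣N-1))) (shape q)
      where
      shape : ∀ x → 1 * x ^ 2 * 1 ^ 3 ≡ x * x
      shape = solve 1 (λ x → con 1 :* x :^ 2 :* con 1 :^ 3 := x :* x) refl
    N%q≡1 : (3 + n) % q ≡ 1
    N%q≡1 = %-offset (p^val∣ p-prime (2 + n)) (≤-trans p≥2 (p≤p^val p-prime p∣N-1))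

  weightPart∣product-p∣N∸2 : p ≢ 2 → p ∣ 1 + n → weightPart p (3 + n) ∣ a * b * c
  weightPart∣product-p∣N∸2 p≢2 p∣N-2 = subst (_∣ a * b * c) (sym T≡q)
    (arranged-∣ (arranged-map (λ {u} {v} → ∣n⇒∣m*n (u * v)) (one-divisible (cf k) N%q≡2)))
    where
    k q : ℕ
    k = val p (1 + n)
    q = p ^ k
    instance
      q≢0 : NonZero q
      q≢0 = m^n≢0 p k
    p∤N-1 : ¬ p ∣ 2 + n
    p∤N-1 p∣N-1 = prime∤1 p-prime (∣m+n∣n⇒∣m {m = 1} p∣N-1 p∣N-2)
    p∤N : ¬ p ∣ 3 + n
    p∤N p∣N = odd-prime∤2 p-prime p≢2 (∣m+n∣n⇒∣m {m = 2} p∣N p∣N-2)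
    T≡q : weightPart p (3 + n) ≡ q
    T≡q = trans (weightPart-vals {p} {3 + n} refl (val≡0 p-prime p∤N-1) (val≡0 p-prime p∤N)) (shape q)
      where
      shape : ∀ x → x * 1 ^ 2 * 1 ^ 3 ≡ x
      shape = solve 1 (λ x → x :* con 1 :^ 2 :* con 1 :^ 3 := x) refl
    N%q≡2 : (3 + n) % q ≡ 2
    N%q≡2 = %-offset (p^val∣ p-prime (1 + n)) (≤-trans (≤∧≢⇒< p≥2 (p≢2 ∘ sym)) (p≤p^val p-prime p∣N-2))

weightPart∣product : ∀ {p N a b c} (p-prime : Prime p) → p ≢ 2 → 3 ≤ N →
  CarryFree p N a b c {{prime⇒nonZero p-prime}} → weightPart p N ∣ a * b * c
weightPart∣product {p} {suc (suc (suc n))} {a} {b} {c} p-prime p≢2 (s≤s (s≤s (s≤s z≤n))) cf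
  with p ∣? 3 + n | p ∣? 2 + n | p ∣? 1 + n
... | yes p∣N | _ | _ = weightPart∣product-p∣N p-prime cf p≢2 p∣N
... | no _ | yes p∣N-1 | _ = weightPart∣product-p∣N∸1 p-prime cf p∣N-1
... | no _ | no _ | yes p∣N-2 = weightPart∣product-p∣N∸2 p-prime cf p≢2 p∣N-2
... | no p∤N | no p∤N-1 | no p∤N-2 = subst (_∣ a * b * c) (sym (weightPart≡1 p-prime p∤N p∤N-1 p∤N-2)) (1∣ _)

module _ {n a b c : ℕ} (cf : CarryFree 2 (3 + n) a b c) where

  2*weightPart∣product-2∣N∸1 : 2 ∣ 2 + n → 2 * weightPart 2 (3 + n) ∣ a * b * c
  2*weightPart∣product-2∣N∸1 2∣N-1 = subst (_∣ a * b * c) (sym 2T≡q*2q) (arranged-∣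
    (arranged-map (λ {u} {v} {w} ((q∣u , q∣v) , bound) → ∣m⇒∣m*n w (∣-pair q∣u q∣v (exact-pair q∣u q∣v bound)))
      (arranged-bounded (cf (suc k)) (pair-divisible (cf k) N%q≡1))))
    where
    k q : ℕ
    k = val 2 (2 + n)
    q = 2 ^ k
    instance
      q≢0 : NonZero q
      q≢0 = m^n≢0 2 k
      2q≢0 : NonZero (2 * q)
      2q≢0 = m^n≢0 2 (suc k)
    2∤N : ¬ 2 ∣ 3 + n
    2∤N 2∣N = prime∤1 prime[2] (∣m+n∣n⇒∣m {m = 1} 2∣N 2∣N-1)
    N%q≡1 : (3 + n) % q ≡ 1
    N%q≡1 = %-offset (p^val∣ prime[2] (2 + n)) (p≤p^val prime[2] 2∣N-1)
    2T≡q*2q : 2 * weightPart 2 (3 + n) ≡ q * (2 * q)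
    2T≡q*2q = trans (cong (2 *_) (weightPart-vals {2} {3 + n}
                      (val≡0 prime[2] (2∤N ∘ ∣m∣n⇒∣m+n ∣-refl)) refl (val≡0 prime[2] 2∤N)))
                    (shape q)
      where
      shape : ∀ x → 2 * (1 * x ^ 2 * 1 ^ 3) ≡ x * (2 * x)
      shape = solve 1 (λ x → con 2 :* (con 1 :* x :^ 2 :* con 1 :^ 3) := x :* (con 2 :* x)) refl

  2*weightPart∣product-4∣N : 4 ∣ 3 + n → 2 * weightPart 2 (3 + n) ∣ a * b * c
  2*weightPart∣product-4∣N 4∣N = subst (_∣ a * b * c) (sym 2T≡2q*2q*q) (arranged-∣
    (arranged-map (λ ((2q∣u , 2q∣v) , q∣w) → *-pres-∣ (*-pres-∣ 2q∣u 2q∣v) q∣w)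
      (arranged-with q∣abc (two-of-three (cf (suc k)) q∣abc))))
    where
    k q : ℕ
    k = val 2 (3 + n)
    q = 2 ^ k
    instance
      q≢0 : NonZero q
      q≢0 = m^n≢0 2 k
      2q≢0 : NonZero (2 * q)
      2q≢0 = m^n≢0 2 (suc k)
    2∣N : 2 ∣ 3 + n
    2∣N = ∣-trans (divides 2 refl) 4∣N
    q∣abc : q ∣ a × q ∣ b × q ∣ c
    q∣abc = all-divisible (cf k) (p^val∣ prime[2] (3 + n))
    2T≡2q*2q*q : 2 * weightPart 2 (3 + n) ≡ 2 * q * (2 * q) * q
    2T≡2q*2q*q = trans (cong (2 *_) (weightPart-vals {2} {3 + n}
                         (val≡1 prime[2] (∣m+n∣m⇒∣n 2∣N ∣-refl) (4∤2 ∘ ∣m+n∣n⇒∣m 4∣N))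
                         (val≡0 prime[2] (prime∤1 prime[2] ∘ ∣m+n∣n⇒∣m 2∣N)) refl))
                       (shape q)
      where
      shape : ∀ x → 2 * (2 ^ 1 * 1 ^ 2 * x ^ 3) ≡ 2 * x * (2 * x) * x
      shape = solve 1 (λ x → con 2 :* (con 2 :^ 1 :* con 1 :^ 2 :* x :^ 3) := con 2 :* x :* (con 2 :* x) :* x) refl

  2*weightPart∣product-4∣N∸2 : 4 ∣ 1 + n → 2 * weightPart 2 (3 + n) ∣ a * b * c
  2*weightPart∣product-4∣N∸2 4∣N-2 = subst (_∣ a * b * c) (sym 2T≡16y) (∣-trans 16y∣y*2y*2 (arranged-∣
    (arranged-map (λ (((y∣u , y∣v) , bound) , 2∣w) → *-pres-∣ (∣-pair y∣u y∣v (exact-pair y∣u y∣v bound)) 2∣w)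
      (arranged-with 2∣abc (arranged-bounded (cf (suc j)) (pair-divisible-even (cf j) N%y≡2 2∣y 2∣abc))))))
    where
    j y : ℕ
    j = val 2 (1 + n)
    y = 2 ^ j
    instance
      y≢0 : NonZero y
      y≢0 = m^n≢0 2 j
      2y≢0 : NonZero (2 * y)
      2y≢0 = m^n≢0 2 (suc j)
    2∣N : 2 ∣ 3 + n
    2∣N = ∣m∣n⇒∣m+n ∣-refl (∣-trans (divides 2 refl) 4∣N-2)
    2∣abc : 2 ∣ a × 2 ∣ b × 2 ∣ c
    2∣abc = all-divisible (cf 1) 2∣N
    4∣y : 4 ∣ y
    4∣y = ∣p^val prime[2] {j = 2} (1 + n) 4∣N-2
    2∣y : 2 ∣ y
    2∣y = ∣-trans (divides 2 refl) 4∣y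
    N%y≡2 : (3 + n) % y ≡ 2
    N%y≡2 = %-offset (p^val∣ prime[2] (1 + n)) (≤-trans (n≤1+n 3) (∣⇒≤ 4∣y))
    16y∣y*2y*2 : 16 * y ∣ y * (2 * y) * 2
    16y∣y*2y*2 = subst₂ _∣_ (sym (16x≡ y)) (sym (x*2x*2≡ y)) (*-monoʳ-∣ (4 * y) 4∣y)
      where
      16x≡ : ∀ x → 16 * x ≡ 4 * x * 4
      16x≡ = solve-∀
      x*2x*2≡ : ∀ x → x * (2 * x) * 2 ≡ 4 * x * x
      x*2x*2≡ = solve-∀
    2T≡16y : 2 * weightPart 2 (3 + n) ≡ 16 * y
    2T≡16y = trans (cong (2 *_) (weightPart-vals {2} {3 + n}
                     refl (val≡0 prime[2] (prime∤1 prime[2] ∘ ∣m+n∣n⇒∣m 2∣N))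
                     (val≡1 prime[2] 2∣N λ 4∣N → 4∤2 (∣m+n∣n⇒∣m 4∣N 4∣N-2))))
                   (shape y)
      where
      shape : ∀ x → 2 * (x * 1 ^ 2 * (2 ^ 1) ^ 3) ≡ 16 * x
      shape = solve 1 (λ x → con 2 :* (x :* con 1 :^ 2 :* (con 2 :^ 1) :^ 3) := con 16 :* x) refl

2*weightPart∣product : ∀ {N a b c} → 3 ≤ N → CarryFree 2 N a b c → 2 * weightPart 2 N ∣ a * b * c
2*weightPart∣product {suc (suc (suc n))} (s≤s (s≤s (s≤s z≤n))) cf with 2∣n⊎2∣1+n (2 + n)
... | inj₁ 2∣N-1 = 2*weightPart∣product-2∣N∸1 cf 2∣N-1
... | inj₂ 2∣N with 2∣m⇒4∣m⊎4∣2+m {1 + n} (∣m+n∣m⇒∣n 2∣N ∣-refl)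
...   | inj₁ 4∣N-2 = 2*weightPart∣product-4∣N∸2 cf 4∣N-2
...   | inj₂ 4∣N = 2*weightPart∣product-4∣N cf 4∣N

acceptable⇒weightPart∣ : ∀ {p N a b c} → Prime p → 3 ≤ N → N ≡ a + b + c → Acceptable p N a b c →
  weightPart p N ∣ a * b * c
acceptable⇒weightPart∣ {p} {N} {a} {b} {c} p-prime 3≤N N≡ acc with p ≟ 2
... | yes refl = ∣-trans (n∣m*n 2) (2*weightPart∣product 3≤N (acceptable⇒carryFree {a = a} {b} {c} p-prime N≡ acc))
... | no p≢2 = weightPart∣product p-prime p≢2 3≤N (acceptable⇒carryFree {a = a} {b} {c} p-prime N≡ acc)

-- Inequalities

4mn≤[m+n]² : ∀ m n → 4 * (m * n) ≤ (m + n) * (m + n)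
4mn≤[m+n]² m n = [ ordered , (λ n≤m → subst₂ _≤_ (cong (4 *_) (*-comm n m)) (cong (λ x → x * x) (+-comm n m)) (ordered n≤m)) ]′
                   (≤-total m n)
  where
  ordered : ∀ {m n} → m ≤ n → 4 * (m * n) ≤ (m + n) * (m + n)
  ordered {m} m≤n with m≤n⇒∃[o]m+o≡n m≤n
  ... | d , refl = subst (4 * (m * (m + d)) ≤_) (sym (expand m d)) (m≤m+n _ (d * d))
    where
    expand : ∀ m d → (m + (m + d)) * (m + (m + d)) ≡ 4 * (m * (m + d)) + d * d
    expand = solve-∀

-- 4(a + s)³ - 27as² = (s - 2a)²(a + 4s); when s ≤ 2a the bound is scaled by 8 to write 2a = s + d.
27as²≤4[a+s]³ : ∀ a s → 27 * (a * (s * s)) ≤ 4 * ((a + s) * (a + s) * (a + s))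
27as²≤4[a+s]³ a s with ≤-total (2 * a) s
... | inj₁ 2a≤s with m≤n⇒∃[o]m+o≡n 2a≤s
...   | d , refl = subst (27 * (a * ((2 * a + d) * (2 * a + d))) ≤_) (sym (expand a d)) (m≤m+n _ _)
  where
  expand : ∀ a d → 4 * ((a + (2 * a + d)) * (a + (2 * a + d)) * (a + (2 * a + d)))
                 ≡ 27 * (a * ((2 * a + d) * (2 * a + d))) + d * d * (9 * a + 4 * d)
  expand = solve-∀
27as²≤4[a+s]³ a s | inj₂ s≤2a with m≤n⇒∃[o]m+o≡n s≤2a
...   | d , s+d≡2a = *-cancelˡ-≤ 8 (begin
  8 * (27 * (a * (s * s)))                                      ≡⟨ double a s ⟩
  108 * ((2 * a) * (s * s))                                     ≡⟨ cong (λ x → 108 * (x * (s * s))) s+d≡2a ⟨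
  108 * ((s + d) * (s * s))                                     ≤⟨ m≤m+n _ _ ⟩
  108 * ((s + d) * (s * s)) + (36 * s * (d * d) + 4 * (d * (d * d)))  ≡⟨ expand s d ⟩
  4 * ((s + d + 2 * s) * (s + d + 2 * s) * (s + d + 2 * s))     ≡⟨ cong (λ x → 4 * ((x + 2 * s) * (x + 2 * s) * (x + 2 * s))) s+d≡2a ⟩
  4 * ((2 * a + 2 * s) * (2 * a + 2 * s) * (2 * a + 2 * s))     ≡⟨ halve a s ⟩
  8 * (4 * ((a + s) * (a + s) * (a + s)))                       ∎)
  where
  open ≤-Reasoning
  double : ∀ a s → 8 * (27 * (a * (s * s))) ≡ 108 * ((2 * a) * (s * s))
  double = solve-∀
  expand : ∀ s d → 108 * ((s + d) * (s * s)) + (36 * s * (d * d) + 4 * (d * (d * d)))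
                 ≡ 4 * ((s + d + 2 * s) * (s + d + 2 * s) * (s + d + 2 * s))
  expand = solve-∀
  halve : ∀ a s → 4 * ((2 * a + 2 * s) * (2 * a + 2 * s) * (2 * a + 2 * s)) ≡ 8 * (4 * ((a + s) * (a + s) * (a + s)))
  halve = solve-∀

amgm3 : ∀ a b c → 27 * (a * b * c) ≤ (a + b + c) ^ 3
amgm3 a b c = *-cancelˡ-≤ 4 (begin
  4 * (27 * (a * b * c))                 ≡⟨ regroup a b c ⟩
  27 * (a * (4 * (b * c)))               ≤⟨ *-monoʳ-≤ 27 (*-monoʳ-≤ a (4mn≤[m+n]² b c)) ⟩
  27 * (a * ((b + c) * (b + c)))         ≤⟨ 27as²≤4[a+s]³ a (b + c) ⟩
  4 * ((a + (b + c)) * (a + (b + c)) * (a + (b + c)))  ≡⟨ cong (4 *_) (cube a b c) ⟩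
  4 * (a + b + c) ^ 3                    ∎)
  where
  open ≤-Reasoning
  regroup : ∀ a b c → 4 * (27 * (a * b * c)) ≡ 27 * (a * (4 * (b * c)))
  regroup = solve-∀
  cube : ∀ a b c → (a + (b + c)) * (a + (b + c)) * (a + (b + c)) ≡ (a + b + c) ^ 3
  cube = solve 3 (λ a b c → (a :+ (b :+ c)) :* (a :+ (b :+ c)) :* (a :+ (b :+ c)) := (a :+ b :+ c) :^ 3) refl

amgm3-dominant : ∀ a b c → b + c ≤ a → 32 * (a * b * c) ≤ (a + b + c) ^ 3
amgm3-dominant a b c b+c≤a with m≤n⇒∃[o]m+o≡n b+c≤a
... | d , refl = begin
  32 * ((b + c + d) * b * c)                           ≡⟨ regroup (b + c + d) b c ⟩
  8 * ((b + c + d) * (4 * (b * c)))                    ≤⟨ *-monoʳ-≤ 8 (*-monoʳ-≤ (b + c + d) (4mn≤[m+n]² b c)) ⟩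
  8 * ((b + c + d) * ((b + c) * (b + c)))              ≤⟨ m≤m+n _ _ ⟩
  8 * ((b + c + d) * ((b + c) * (b + c))) + (4 * ((b + c) * (b + c)) * d + 6 * (b + c) * (d * d) + d * (d * d))
                                                       ≡⟨ expand (b + c) d ⟩
  (b + c + d + (b + c)) ^ 3                            ≡⟨ cong (_^ 3) (+-assoc (b + c + d) b c) ⟨
  (b + c + d + b + c) ^ 3                              ∎
  where
  open ≤-Reasoning
  regroup : ∀ a b c → 32 * (a * b * c) ≡ 8 * (a * (4 * (b * c)))
  regroup = solve-∀
  expand : ∀ s d → 8 * ((s + d) * (s * s)) + (4 * (s * s) * d + 6 * s * (d * d) + d * (d * d)) ≡ (s + d + s) ^ 3
  expand = solve 2 (λ s d → con 8 :* ((s :+ d) :* (s :* s)) :+ (con 4 :* (s :* s) :* d :+ con 6 :* s :* (d :* d) :+ d :* (d :* d))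
                            := (s :+ d :+ s) :^ 3) refl

dominant-amgm3 : ∀ {a b c} → Arranged (λ u v w → u + v ≤ w) a b c → 32 * (a * b * c) ≤ (a + b + c) ^ 3
dominant-amgm3 {a} {b} {c} (pair-ab a+b≤c) = subst₂ (λ x y → 32 * x ≤ y ^ 3) (cab a b c) (c+a+b a b c) (amgm3-dominant c a b a+b≤c)
  where
  cab : ∀ a b c → c * a * b ≡ a * b * c
  cab = solve-∀
  c+a+b : ∀ a b c → c + a + b ≡ a + b + c
  c+a+b = solve-∀
dominant-amgm3 {a} {b} {c} (pair-ac a+c≤b) = subst₂ (λ x y → 32 * x ≤ y ^ 3) (cong (_* c) (*-comm b a)) (cong (_+ c) (+-comm b a)) (amgm3-dominant b a c a+c≤b)
dominant-amgm3 (pair-bc b+c≤a) = amgm3-dominant _ _ _ b+c≤a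

2^t≤n<2^[1+t] : ∀ n .{{_ : NonZero n}} → ∃[ t ] 2 ^ t ≤ n × n < 2 ^ suc t
2^t≤n<2^[1+t] (suc zero) = 0 , ≤-refl , s≤s (s≤s z≤n)
2^t≤n<2^[1+t] (suc (suc m)) with 2^t≤n<2^[1+t] (suc m)
... | t , 2^t≤1+m , 1+m<2^[1+t] with m≤n⇒m<n∨m≡n 1+m<2^[1+t]
...   | inj₁ 2+m<2^[1+t] = t , ≤-trans 2^t≤1+m (n≤1+n _) , 2+m<2^[1+t]
...   | inj₂ 2+m≡2^[1+t] = suc t , ≤-reflexive (sym 2+m≡2^[1+t]) ,
        subst (_< 2 ^ suc (suc t)) (sym 2+m≡2^[1+t]) (^-monoʳ-< 2 (s≤s (s≤s z≤n)) (n<1+n (suc t)))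

half-dominates : ∀ {h x r} → h ≤ x → x + r < 2 * h → r ≤ x
half-dominates {h} {x} {r} h≤x x+r<2h = ≤-trans (<⇒≤ r<h) h≤x
  where
  r<h : r < h
  r<h = +-cancelˡ-< h r h (begin-strict
    h + r         ≤⟨ +-monoˡ-≤ r h≤x ⟩
    x + r         <⟨ x+r<2h ⟩
    2 * h         ≡⟨ cong (λ y → h + y) (+-identityʳ h) ⟩
    h + h         ∎)
    where open ≤-Reasoning

carryFree⇒dominant : ∀ {N a b c} .{{_ : NonZero N}} → N ≡ a + b + c → CarryFree 2 N a b c →
  Arranged (λ u v w → u + v ≤ w) a b c
carryFree⇒dominant {N} {a} {b} {c} N≡ cf with 2^t≤n<2^[1+t] N
... | t , 2^t≤N , N<2^[1+t] with 2 ^ t ≤? c | 2 ^ t ≤? b | 2 ^ t ≤? a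
...   | yes 2^t≤c | _ | _ = pair-ab (half-dominates 2^t≤c (subst (_< 2 ^ suc t) (trans N≡ (c+[a+b] a b c)) N<2^[1+t]))
  where
  c+[a+b] : ∀ a b c → a + b + c ≡ c + (a + b)
  c+[a+b] = solve-∀
...   | no _ | yes 2^t≤b | _ = pair-ac (half-dominates 2^t≤b (subst (_< 2 ^ suc t) (trans N≡ (b+[a+c] a b c)) N<2^[1+t]))
  where
  b+[a+c] : ∀ a b c → a + b + c ≡ b + (a + c)
  b+[a+c] = solve-∀
...   | no _ | no _ | yes 2^t≤a = pair-bc (half-dominates 2^t≤a (subst (_< 2 ^ suc t) (trans N≡ (+-assoc a b c)) N<2^[1+t]))
...   | no 2^t≰c | no 2^t≰b | no 2^t≰a = contradiction (subst (_< 2 ^ t) N%2^t≡N (m%n<n N (2 ^ t))) (≤⇒≯ 2^t≤N)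
  where
  instance
    2^t≢0 : NonZero (2 ^ t)
    2^t≢0 = m^n≢0 2 t
  small : ∀ {x} → ¬ 2 ^ t ≤ x → x % 2 ^ t ≡ x
  small 2^t≰x = m<n⇒m%n≡m (≰⇒> 2^t≰x)
  N%2^t≡N : N % 2 ^ t ≡ N
  N%2^t≡N = begin
    N % 2 ^ t                              ≡⟨ CarryFreeMod.residues (cf t) ⟨
    a % 2 ^ t + b % 2 ^ t + c % 2 ^ t      ≡⟨ cong₂ _+_ (cong₂ _+_ (small 2^t≰a) (small 2^t≰b)) (small 2^t≰c) ⟩
    a + b + c                              ≡⟨ N≡ ⟨
    N                                      ∎
    where open ≡-Reasoning

weight-lower-bound : ∀ m → m * (4 + m) ^ 5 < weight (4 + m)
weight-lower-bound m = subst (m * (4 + m) ^ 5 <_) (sym (expand m))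
  (m<m+n _ (>-nonZero⁻¹ _ {{m*n≢0 ((4 + m) ^ 3) (18 + 5 * m) {{m^n≢0 (4 + m) 3}}}}))
  where
  expand : ∀ m → (2 + m) * (3 + m) ^ 2 * (4 + m) ^ 3 ≡ m * (4 + m) ^ 5 + (4 + m) ^ 3 * (18 + 5 * m)
  expand = solve 1 (λ m → (con 2 :+ m) :* (con 3 :+ m) :^ 2 :* (con 4 :+ m) :^ 3
                          := m :* (con 4 :+ m) :^ 5 :+ (con 4 :+ m) :^ 3 :* (con 18 :+ con 5 :* m)) refl

weight-bound⇒linear-bound : ∀ {K C N} .{{_ : NonZero K}} .{{_ : NonZero C}} → 3 ≤ N →
  K * weight N ≤ C * (N ^ 3 * N ^ 3) → K * (N ∸ 4) < C * N
weight-bound⇒linear-bound {K} {C} {N} 3≤N K*W≤ with m≤n⇒∃[o]m+o≡n 3≤N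
... | zero , refl = subst (_< C * 3) (sym (*-zeroʳ K)) (>-nonZero⁻¹ (C * 3) {{m*n≢0 C 3}})
... | suc m , refl = *-cancelʳ-< ((4 + m) ^ 5) _ _ (begin-strict
  K * m * (4 + m) ^ 5          ≡⟨ *-assoc K m _ ⟩
  K * (m * (4 + m) ^ 5)        <⟨ *-monoʳ-< K (weight-lower-bound m) ⟩
  K * weight (4 + m)           ≤⟨ K*W≤ ⟩
  C * ((4 + m) ^ 3 * (4 + m) ^ 3) ≡⟨ regroup C (4 + m) ⟩
  C * (4 + m) * (4 + m) ^ 5    ∎)
  where
  open ≤-Reasoning
  regroup : ∀ c n → c * (n ^ 3 * n ^ 3) ≡ c * n * n ^ 5
  regroup = solve 2 (λ c n → c :* (n :^ 3 :* n :^ 3) := c :* n :* n :^ 5) refl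

linear-bound⇒ℤ : ∀ {K C N} → K * (N ∸ 4) < C * N → + K *ℤ (+ N - + 4) <ℤ + C *ℤ + N
linear-bound⇒ℤ {K} {C} {N} lt = ℤ.≤-<-trans (ℤ.*-monoˡ-≤-nonNeg (+ K) N-4≤)
  (subst₂ _<ℤ_ (ℤ.pos-* K (N ∸ 4)) (ℤ.pos-* C N) (ℤ.+<+ lt))
  where
  N-4≤ : + N - + 4 ≤ℤ + (N ∸ 4)
  N-4≤ with 4 ≤? N
  ... | yes 4≤N = ℤ.≤-reflexive (trans (ℤ.[+m]-[+n]≡m⊖n N 4) (ℤ.⊖-≥ 4≤N))
  ... | no 4≰N = subst (_≤ℤ + (N ∸ 4)) (sym (trans (ℤ.[+m]-[+n]≡m⊖n N 4) (ℤ.⊖-≰ 4≰N))) ℤ.neg-≤-pos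

linear-bound⇒threshold : ∀ {K C N} L k s → K * (N ∸ 4) < C * N → 4 + k ≤ N →
  (∀ r → K * (k + r) ≡ L * (4 + (k + r)) + s * r) → L < C
linear-bound⇒threshold {K} {C} {N} L k s lt 4+k≤N identity with L <? C
... | yes L<C = L<C
... | no L≮C = contradiction (≤-<-trans (*-monoˡ-≤ N (≮⇒≥ L≮C)) (≤-<-trans L*N≤ lt)) (n≮n (C * N))
  where
  m r : ℕ
  m = N ∸ 4
  k≤m : k ≤ m
  k≤m = subst (_≤ m) (m+n∸m≡n 4 k) (∸-monoˡ-≤ 4 4+k≤N)
  r = m ∸ k
  k+r≡m : k + r ≡ m
  k+r≡m = m+[n∸m]≡n k≤m
  L*N≤ : L * N ≤ K * m
  L*N≤ = begin
    L * N                          ≡⟨ cong (L *_) (m+[n∸m]≡n (≤-trans (m≤m+n 4 k) 4+k≤N)) ⟨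
    L * (4 + m)                    ≡⟨ cong (λ x → L * (4 + x)) k+r≡m ⟨
    L * (4 + (k + r))              ≤⟨ m≤m+n _ (s * r) ⟩
    L * (4 + (k + r)) + s * r      ≡⟨ identity r ⟨
    K * (k + r)                    ≡⟨ cong (K *_) k+r≡m ⟩
    K * m                          ∎
    where open ≤-Reasoning


module Bounds {N a₁ a₂ a₃ b₁ b₂ b₃ : ℕ}
  (a₁>0 : 0 < a₁) (a₂>0 : 0 < a₂) (a₃>0 : 0 < a₃) (b₁>0 : 0 < b₁) (b₂>0 : 0 < b₂) (b₃>0 : 0 < b₃)
  (N≡a : N ≡ a₁ + a₂ + a₃) (N≡b : N ≡ b₁ + b₂ + b₃) where

  private
    D C′ A B : ℕ
    D = N * (N ∸ 1) * (N ∸ 2)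
    C′ = C N a₁ a₂ a₃ b₁ b₂ b₃
    A = a₁ * a₂ * a₃
    B = b₁ * b₂ * b₃

  3≤N : 3 ≤ N
  3≤N = subst (3 ≤_) (sym N≡a) (+-mono-≤ (+-mono-≤ a₁>0 a₂>0) a₃>0)

  relevant-contrib : ∀ {p} → Relevant N a₁ a₂ a₃ b₁ b₂ b₃ p → contrib N a₁ a₂ a₃ b₁ b₂ b₃ p ≡ weightPart p N
  relevant-contrib {p} rel =
    cong (λ b → if b then weightPart p N else 1) (dec-true (relevant? N a₁ a₂ a₃ b₁ b₂ b₃ p) rel)

  irrelevant-contrib : ∀ {p} → ¬ Relevant N a₁ a₂ a₃ b₁ b₂ b₃ p → contrib N a₁ a₂ a₃ b₁ b₂ b₃ p ≡ 1
  irrelevant-contrib {p} irr =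
    cong (λ b → if b then weightPart p N else 1) (dec-false (relevant? N a₁ a₂ a₃ b₁ b₂ b₃ p) irr)

  private instance
    N≢0 : NonZero N
    N≢0 = >-nonZero (≤-trans (s≤s z≤n) 3≤N)
    N-1≢0 : NonZero (N ∸ 1)
    N-1≢0 = >-nonZero (∸-monoˡ-≤ 1 (≤-trans (s≤s (s≤s z≤n)) 3≤N))
    N-2≢0 : NonZero (N ∸ 2)
    N-2≢0 = >-nonZero (∸-monoˡ-≤ 2 3≤N)

  instance
    C≢0 : NonZero C′
    C≢0 = product≢0 (All.map⁺ (All.universal contrib≢0 (upTo (suc N))))
      where
      contrib≢0 : ∀ p → NonZero (contrib N a₁ a₂ a₃ b₁ b₂ b₃ p)
      contrib≢0 p with relevant? N a₁ a₂ a₃ b₁ b₂ b₃ p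
      ... | yes rel = subst NonZero (sym (relevant-contrib rel)) (>-nonZero (weightPart>0 (proj₁ rel) N))
      ... | no irr = subst NonZero (sym (irrelevant-contrib irr)) (>-nonZero z<s)

  private instance
    C*A*B≢0 : NonZero (C′ * (A * B))
    C*A*B≢0 = >-nonZero (*-mono-≤ (>-nonZero⁻¹ C′)
      (*-mono-≤ (*-mono-≤ (*-mono-≤ a₁>0 a₂>0) a₃>0) (*-mono-≤ (*-mono-≤ b₁>0 b₂>0) b₃>0)))

  prime∣D⇒≤N : ∀ {p} → Prime p → p ∣ D → p ≤ N
  prime∣D⇒≤N p-prime p∣D with euclidsLemma (N * (N ∸ 1)) (N ∸ 2) p-prime p∣D
  ... | inj₂ p∣N-2 = ≤-trans (∣⇒≤ p∣N-2) (m∸n≤m N 2)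
  ... | inj₁ p∣N*[N-1] with euclidsLemma N (N ∸ 1) p-prime p∣N*[N-1]
  ...   | inj₁ p∣N = ∣⇒≤ p∣N
  ...   | inj₂ p∣N-1 = ≤-trans (∣⇒≤ p∣N-1) (m∸n≤m N 1)

  2∣D : 2 ∣ D
  2∣D with 2∣n⊎2∣1+n (N ∸ 1)
  ... | inj₁ 2∣N-1 = ∣m⇒∣m*n (N ∸ 2) (∣n⇒∣m*n N 2∣N-1)
  ... | inj₂ 2∣N = ∣m⇒∣m*n (N ∸ 2) (∣m⇒∣m*n (N ∸ 1) (subst (2 ∣_) (suc-pred N) 2∣N))

  weightPart∣C*A*B : ∀ {p} → Prime p → weightPart p N ∣ C′ * (A * B)
  weightPart∣C*A*B {p} p-prime with relevant? N a₁ a₂ a₃ b₁ b₂ b₃ p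
  ... | yes rel@(_ , p∣D , _) = ∣m⇒∣m*n (A * B) (subst (_∣ C′) (relevant-contrib rel)
        (∈⇒∣product (∈-map⁺ (contrib N a₁ a₂ a₃ b₁ b₂ b₃) (∈-upTo⁺ (s≤s (prime∣D⇒≤N p-prime p∣D))))))
  ... | no irrelevant with acceptable? p N a₁ a₂ a₃ | acceptable? p N b₁ b₂ b₃ | p ∣? D
  ...   | yes accA | _ | _ = ∣n⇒∣m*n C′ (∣m⇒∣m*n B (acceptable⇒weightPart∣ {a = a₁} {a₂} {a₃} p-prime 3≤N N≡a accA))
  ...   | no _ | yes accB | _ = ∣n⇒∣m*n C′ (∣n⇒∣m*n A (acceptable⇒weightPart∣ {a = b₁} {b₂} {b₃} p-prime 3≤N N≡b accB))
  ...   | no ¬accA | no ¬accB | yes p∣D = contradiction (p-prime , p∣D , ¬accA , ¬accB) irrelevant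
  ...   | no _ | no _ | no p∤D = subst (_∣ C′ * (A * B)) (sym (weightPart≡1 p-prime
          (p∤D ∘ ∣m⇒∣m*n (N ∸ 2) ∘ ∣m⇒∣m*n {m = N} (N ∸ 1))
          (p∤D ∘ ∣m⇒∣m*n (N ∸ 2) ∘ ∣n⇒∣m*n N)
          (p∤D ∘ ∣n⇒∣m*n (N * (N ∸ 1))))) (1∣ _)

  weight∣C*A*B : weight N ∣ C′ * (A * B)
  weight∣C*A*B = ∣-byPrimeParts (weight N) {{>-nonZero (weight>0 3≤N)}} parts
    where
    parts : ∀ {p} → Prime p → ∃₂ λ d u → weight N ≡ d * u × ¬ p ∣ u × d ∣ C′ * (A * B)
    parts p-prime with weight-split p-prime 3≤N
    ... | u , W≡T*u , p∤u = _ , u , W≡T*u , p∤u , weightPart∣C*A*B p-prime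

  2-acceptable : ¬ Relevant N a₁ a₂ a₃ b₁ b₂ b₃ 2 → Acceptable 2 N a₁ a₂ a₃ ⊎ Acceptable 2 N b₁ b₂ b₃
  2-acceptable irrelevant with acceptable? 2 N a₁ a₂ a₃ | acceptable? 2 N b₁ b₂ b₃
  ... | yes accA | _ = inj₁ accA
  ... | no _ | yes accB = inj₂ accB
  ... | no ¬accA | no ¬accB = contradiction (prime[2] , 2∣D , ¬accA , ¬accB) irrelevant

  2*weight∣C*A*B : Acceptable 2 N a₁ a₂ a₃ ⊎ Acceptable 2 N b₁ b₂ b₃ → 2 * weight N ∣ C′ * (A * B)
  2*weight∣C*A*B acc = ∣-byPrimeParts (2 * weight N) {{m*n≢0 2 (weight N) {{_}} {{>-nonZero (weight>0 3≤N)}}}} parts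
    where
    2T∣ : Acceptable 2 N a₁ a₂ a₃ ⊎ Acceptable 2 N b₁ b₂ b₃ → 2 * weightPart 2 N ∣ C′ * (A * B)
    2T∣ (inj₁ accA) = ∣n⇒∣m*n C′ (∣m⇒∣m*n B
      (2*weightPart∣product 3≤N (acceptable⇒carryFree {a = a₁} {a₂} {a₃} prime[2] N≡a accA)))
    2T∣ (inj₂ accB) = ∣n⇒∣m*n C′ (∣n⇒∣m*n A
      (2*weightPart∣product 3≤N (acceptable⇒carryFree {a = b₁} {b₂} {b₃} prime[2] N≡b accB)))
    swap : ∀ x y z → x * (y * z) ≡ y * (x * z)
    swap = solve-∀
    parts : ∀ {p} → Prime p → ∃₂ λ d u → 2 * weight N ≡ d * u × ¬ p ∣ u × d ∣ C′ * (A * B)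
    parts {p} p-prime with p ≟ 2 | weight-split p-prime 3≤N
    ... | yes refl | u , W≡T*u , 2∤u =
      2 * weightPart 2 N , u , trans (cong (2 *_) W≡T*u) (sym (*-assoc 2 (weightPart 2 N) u)) , 2∤u , 2T∣ acc
    ... | no p≢2 | u , W≡T*u , p∤u =
      weightPart p N , 2 * u , trans (cong (2 *_) W≡T*u) (swap 2 (weightPart p N) u) ,
      prime∤* p-prime (prime∤prime prime[2] p-prime p≢2) p∤u , weightPart∣C*A*B p-prime

  scaled-bound : ∀ {e k M} → e * weight N ∣ C′ * (A * B) → k * (A * B) ≤ M → k * e * weight N ≤ C′ * M
  scaled-bound {e} {k} {M} e*W∣ k*A*B≤M = begin
    k * e * weight N      ≡⟨ *-assoc k e _ ⟩
    k * (e * weight N)    ≤⟨ *-monoʳ-≤ k (∣⇒≤ e*W∣) ⟩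
    k * (C′ * (A * B))    ≡⟨ swap k C′ (A * B) ⟩
    C′ * (k * (A * B))    ≤⟨ *-monoʳ-≤ C′ k*A*B≤M ⟩
    C′ * M                ∎
    where
    open ≤-Reasoning
    swap : ∀ x y z → x * (y * z) ≡ y * (x * z)
    swap = solve-∀

  27A≤N³ : 27 * A ≤ N ^ 3
  27A≤N³ = subst (λ x → 27 * A ≤ x ^ 3) (sym N≡a) (amgm3 a₁ a₂ a₃)

  27B≤N³ : 27 * B ≤ N ^ 3
  27B≤N³ = subst (λ x → 27 * B ≤ x ^ 3) (sym N≡b) (amgm3 b₁ b₂ b₃)

  32A≤N³ : Acceptable 2 N a₁ a₂ a₃ → 32 * A ≤ N ^ 3
  32A≤N³ acc = subst (λ x → 32 * A ≤ x ^ 3) (sym N≡a)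
    (dominant-amgm3 (carryFree⇒dominant N≡a (acceptable⇒carryFree {a = a₁} {a₂} {a₃} prime[2] N≡a acc)))

  32B≤N³ : Acceptable 2 N b₁ b₂ b₃ → 32 * B ≤ N ^ 3
  32B≤N³ acc = subst (λ x → 32 * B ≤ x ^ 3) (sym N≡b)
    (dominant-amgm3 (carryFree⇒dominant N≡b (acceptable⇒carryFree {a = b₁} {b₂} {b₃} prime[2] N≡b acc)))

  729*weight≤ : 729 * weight N ≤ C′ * (N ^ 3 * N ^ 3)
  729*weight≤ = scaled-bound {e = 1} {k = 729} (subst (_∣ C′ * (A * B)) (sym (*-identityˡ (weight N))) weight∣C*A*B)
    (subst (_≤ N ^ 3 * N ^ 3) (sym (regroup A B)) (*-mono-≤ 27A≤N³ 27B≤N³))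
    where
    regroup : ∀ x y → 729 * (x * y) ≡ 27 * x * (27 * y)
    regroup = solve-∀

  1728*weight≤ : ¬ Relevant N a₁ a₂ a₃ b₁ b₂ b₃ 2 → 1728 * weight N ≤ C′ * (N ^ 3 * N ^ 3)
  1728*weight≤ irrelevant = scaled-bound {e = 2} {k = 864} (2*weight∣C*A*B acc) (864AB≤N⁶ acc)
    where
    acc : Acceptable 2 N a₁ a₂ a₃ ⊎ Acceptable 2 N b₁ b₂ b₃
    acc = 2-acceptable irrelevant
    regroup₁ : ∀ x y → 864 * (x * y) ≡ 32 * x * (27 * y)
    regroup₁ = solve-∀
    regroup₂ : ∀ x y → 864 * (x * y) ≡ 27 * x * (32 * y)
    regroup₂ = solve-∀
    864AB≤N⁶ : Acceptable 2 N a₁ a₂ a₃ ⊎ Acceptable 2 N b₁ b₂ b₃ → 864 * (A * B) ≤ N ^ 3 * N ^ 3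
    864AB≤N⁶ (inj₁ accA) = subst (_≤ N ^ 3 * N ^ 3) (sym (regroup₁ A B)) (*-mono-≤ (32A≤N³ accA) 27B≤N³)
    864AB≤N⁶ (inj₂ accB) = subst (_≤ N ^ 3 * N ^ 3) (sym (regroup₂ A B)) (*-mono-≤ 27A≤N³ (32B≤N³ accB))

  linear-729 : 729 * (N ∸ 4) < C′ * N
  linear-729 = weight-bound⇒linear-bound {K = 729} {C = C′} 3≤N 729*weight≤

  linear-1728 : ¬ Relevant N a₁ a₂ a₃ b₁ b₂ b₃ 2 → 1728 * (N ∸ 4) < C′ * N
  linear-1728 irrelevant = weight-bound⇒linear-bound {K = 1728} {C = C′} 3≤N (1728*weight≤ irrelevant)

lemma7p2 : (N a₁ a₂ a₃ b₁ b₂ b₃ : ℕ)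
    → 0 < a₁ → 0 < a₂ → 0 < a₃ → 0 < b₁ → 0 < b₂ → 0 < b₃
    → N ≡ a₁ + a₂ + a₃ → N ≡ b₁ + b₂ + b₃
    → ((+ 729) *ℤ (+ N - + 4) <ℤ + (C N a₁ a₂ a₃ b₁ b₂ b₃) *ℤ + N)
    × (12 ≤ N → C N a₁ a₂ a₃ b₁ b₂ b₃ > 486)
    × (81 ≤ N → C N a₁ a₂ a₃ b₁ b₂ b₃ > 693)
    × (¬ Relevant N a₁ a₂ a₃ b₁ b₂ b₃ 2
    → (+ 1728) *ℤ (+ N - + 4) <ℤ + (C N a₁ a₂ a₃ b₁ b₂ b₃) *ℤ + N)
lemma7p2 N a₁ a₂ a₃ b₁ b₂ b₃ a₁>0 a₂>0 a₃>0 b₁>0 b₂>0 b₃>0 N≡a N≡b =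
    linear-bound⇒ℤ {729} {C′} linear-729
  , (λ 12≤N → linear-bound⇒threshold {729} {C′} 486 8 243 linear-729 12≤N split-486)
  , (λ 81≤N → linear-bound⇒threshold {729} {C′} 693 77 36 linear-729 81≤N split-693)
  , (λ 2-irrelevant → linear-bound⇒ℤ {1728} {C′} (linear-1728 2-irrelevant))
  where
  open Bounds a₁>0 a₂>0 a₃>0 b₁>0 b₂>0 b₃>0 N≡a N≡b
  C′ : ℕ
  C′ = C N a₁ a₂ a₃ b₁ b₂ b₃
  split-486 : ∀ r → 729 * (8 + r) ≡ 486 * (4 + (8 + r)) + 243 * r
  split-486 = solve-∀
  split-693 : ∀ r → 729 * (77 + r) ≡ 693 * (4 + (77 + r)) + 36 * r
  split-693 = solve-∀
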